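{- Let $k\ge1$ and $n,p\ge0$ be integers. The number of words $\pi\in[2k]^n$ with $\overleftarrow{\mathrm{des}}_E(\pi)=p$, which also equals the number of words $\pi\in[2k]^n$ with $\overleftarrow{\mathrm{ris}}_O(\pi)=p$, is $$\sum_{j=0}^n\sum_{i_1=0}^j\sum_{i_2=0}^j(-1)^{n+p+i_2}2^{j-i_1}\binom{j}{i_1}\binom{j}{i_2}\binom{ki_2}{n-i_1}\binom{n-j}{p}.$$
   Context: $[N]=\{1,\ldots,N\}$, $[N]^n$ is the set of words of length $n$ over $[N]$. $E=\{2,4,6,\ldots\}$, $O=\{1,3,5,\ldots\}$. For a word $\pi=\pi_1\cdots\pi_n$ and $X\subseteq\mathbb{N}$, $\overleftarrow{\mathrm{des}}_X(\pi)=|\{i:\pi_i>\pi_{i+1},\ \pi_i\in X\}|$ and $\overleftarrow{\mathrm{ris}}_X(\pi)=|\{i:\pi_i<\pi_{i+1},\ \pi_i\in X\}|$. Convention: $\binom{a}{b}=0$ if $b<0$ or $b>a$ (for $a\ge0$). -}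

module Defs where

open import Data.Nat using (ℕ; zero; suc; _+_; _*_; _∸_; _<ᵇ_)
open import Data.Nat.Combinatorics using (_C_)
open import Data.Bool using (Bool; true; false; _∧_; if_then_else_; not)
open import Data.List using (List; []; _∷_; map; concatMap; length; filterᵇ; upTo; sum)
open import Data.Integer as ℤ using (ℤ)

isEven : ℕ → Bool
isEven zero = true
isEven (suc n) = not (isEven n)

isOdd : ℕ → Bool
isOdd n = not (isEven n)

letters : ℕ → List ℕ
letters N = map suc (upTo N)

words : ℕ → ℕ → List (List ℕ)
words N zero = [] ∷ []
words N (suc n) = concatMap (λ a → map (a ∷_) (words N n)) (letters N)

desX : (ℕ → Bool) → List ℕ → ℕ
desX X [] = 0
desX X (a ∷ []) = 0
desX X (a ∷ b ∷ w) = (if (b <ᵇ a) ∧ X a then 1 else 0) + desX X (b ∷ w)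

risX : (ℕ → Bool) → List ℕ → ℕ
risX X [] = 0
risX X (a ∷ []) = 0
risX X (a ∷ b ∷ w) = (if (a <ᵇ b) ∧ X a then 1 else 0) + risX X (b ∷ w)

countWords : ℕ → ℕ → (List ℕ → Bool) → ℕ
countWords N n P = length (filterᵇ P (words N n))

sumTo : ℕ → (ℕ → ℤ) → ℤ
sumTo zero f = f 0
sumTo (suc m) f = sumTo m f ℤ.+ f (suc m)

sign : ℕ → ℤ
sign e = if isEven e then ℤ.+ 1 else ℤ.- (ℤ.+ 1)

rhs : ℕ → ℕ → ℕ → ℤ
rhs k n p =
  sumTo n λ j → sumTo j λ i₁ → sumTo j λ i₂ →
    sign (n + p + i₂) ℤ.*
    ℤ.+ ((2 Data.Nat.^ (j ∸ i₁)) * (j C i₁) * (j C i₂) * ((k * i₂) C (n ∸ i₁)) * ((n ∸ j) C p))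

{-# OPTIONS --safe #-}
-- Call a nonempty word a block if each of its adjacent pairs is a descent from an even letter.
-- Writing t = 1 + (t − 1) in t ^ des_E(w) and expanding gives
-- t ^ des_E(w) = Σⱼ B(w, j) (t − 1) ^ (|w| − j), where B(w, j) is the number of ways to cut w into
-- j blocks.  Summing over [N]ⁿ, the number of words with p such descents is
-- Σⱼ T(n, j) (−1)^(n−j−p) (n − j choose p), where T(n, j) counts the words of length n cut into
-- j blocks.  Splitting off the first letter shows T(n, j) = [xⁿ] Q(x)ʲ for the generating function
-- Q of the blocks over [N]; for N = 2k it is Q = (2 + x)((1 + x)ᵏ − 1), and the binomial theorem
-- extracts the coefficients.  Finally a ↦ 2k + 1 − a reverses the order of [2k] and swaps
-- parities, so it turns ascents from odd letters into descents from even letters.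
module Submission where

open import Defs
open import Data.Bool using (Bool; true; false; if_then_else_; not; _∧_; T)
open import Data.Bool.Properties using (∧-identityʳ; ∧-zeroʳ; not-involutive)
open import Data.Empty using (⊥-elim)
open import Data.Integer using (ℤ; +_; -_; _+_; _-_; _*_; 0ℤ; 1ℤ; -1ℤ)
open import Data.Integer.Properties
open import Data.Integer.Tactic.RingSolver using (solve-∀)
open import Data.List using (List; []; _∷_; _++_; map; length; filterᵇ; concatMap; applyUpTo; upTo)
open import Data.List.Properties using (filter-++; length-++; concatMap-map)
open import Data.List.Relation.Unary.All using (All; []; _∷_)
open import Data.Nat as ℕ using (ℕ; zero; suc; _≤_; _<_; _≡ᵇ_; _<ᵇ_; z≤n; s≤s)
import Data.Nat.Properties as ℕ
open import Data.Nat.Combinatorics using (_C_; nCk+nC[k+1]≡[n+1]C[k+1])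
open import Data.Nat.Combinatorics.Specification using (k>n⇒nCk≡0)
import Data.Nat.Tactic.RingSolver as ℕ-Solver
open import Data.Product using (_×_; _,_)
open import Data.Unit using (tt)
open import Function using (_∘_; id)
open import Relation.Nullary using (yes; no; contradiction)
open import Relation.Nullary.Decidable using (T?)
open import Relation.Nullary.Reflects using (det; fromEquivalence)
open import Relation.Binary.PropositionalEquality
open ≡-Reasoning

Σ< : ℕ → (ℕ → ℤ) → ℤ
Σ< zero    f = 0ℤ
Σ< (suc n) f = Σ< n f + f n

syntax Σ< n (λ i → e) = Σ[ i < n ] e

Σ-cong-< : ∀ n {f g : ℕ → ℤ} → (∀ i → i < n → f i ≡ g i) → Σ< n f ≡ Σ< n g
Σ-cong-< zero    f≡g = refl
Σ-cong-< (suc n) f≡g =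
  cong₂ _+_ (Σ-cong-< n (λ i i<n → f≡g i (ℕ.m<n⇒m<1+n i<n))) (f≡g n (ℕ.n<1+n n))

Σ-cong : ∀ n {f g : ℕ → ℤ} → (∀ i → f i ≡ g i) → Σ< n f ≡ Σ< n g
Σ-cong n f≡g = Σ-cong-< n (λ i _ → f≡g i)

Σ-zero : ∀ n {f : ℕ → ℤ} → (∀ i → i < n → f i ≡ 0ℤ) → Σ< n f ≡ 0ℤ
Σ-zero zero    f≡0 = refl
Σ-zero (suc n) f≡0 =
  cong₂ _+_ (Σ-zero n (λ i i<n → f≡0 i (ℕ.m<n⇒m<1+n i<n))) (f≡0 n (ℕ.n<1+n n))

Σ-distrib-+ : ∀ n (f g : ℕ → ℤ) → Σ[ i < n ] (f i + g i) ≡ Σ< n f + Σ< n g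
Σ-distrib-+ zero    f g = refl
Σ-distrib-+ (suc n) f g = begin
  Σ[ i < n ] (f i + g i) + (f n + g n)  ≡⟨ cong (_+ (f n + g n)) (Σ-distrib-+ n f g) ⟩
  Σ< n f + Σ< n g + (f n + g n)         ≡⟨ interchange (Σ< n f) (Σ< n g) (f n) (g n) ⟩
  Σ< n f + f n + (Σ< n g + g n)         ∎
  where
  interchange : ∀ a b c d → a + b + (c + d) ≡ a + c + (b + d)
  interchange = solve-∀

*-distribˡ-Σ : ∀ n c (f : ℕ → ℤ) → c * Σ< n f ≡ Σ[ i < n ] (c * f i)
*-distribˡ-Σ zero    c f = *-zeroʳ c
*-distribˡ-Σ (suc n) c f =
  trans (*-distribˡ-+ c (Σ< n f) (f n)) (cong (_+ c * f n) (*-distribˡ-Σ n c f))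

*-distribʳ-Σ : ∀ n c (f : ℕ → ℤ) → Σ< n f * c ≡ Σ[ i < n ] (f i * c)
*-distribʳ-Σ n c f = begin
  Σ< n f * c            ≡⟨ *-comm (Σ< n f) c ⟩
  c * Σ< n f            ≡⟨ *-distribˡ-Σ n c f ⟩
  Σ[ i < n ] (c * f i)  ≡⟨ Σ-cong n (λ i → *-comm c (f i)) ⟩
  Σ[ i < n ] (f i * c)  ∎

Σ-uncons : ∀ n (f : ℕ → ℤ) → Σ< (suc n) f ≡ f 0 + Σ[ i < n ] f (suc i)
Σ-uncons zero    f = trans (+-identityˡ (f 0)) (sym (+-identityʳ (f 0)))
Σ-uncons (suc n) f = trans (cong (_+ f (suc n)) (Σ-uncons n f)) (+-assoc (f 0) _ _)

Σ-comm : ∀ m n (f : ℕ → ℕ → ℤ) →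
  Σ[ i < m ] Σ[ j < n ] f i j ≡ Σ[ j < n ] Σ[ i < m ] f i j
Σ-comm zero    n f = sym (Σ-zero n (λ _ _ → refl))
Σ-comm (suc m) n f =
  trans (cong (_+ Σ< n (f m)) (Σ-comm m n f)) (sym (Σ-distrib-+ n _ (f m)))

Σ-truncate : ∀ {m n} {f : ℕ → ℤ} → m ≤ n → (∀ i → m ≤ i → f i ≡ 0ℤ) → Σ< n f ≡ Σ< m f
Σ-truncate {m} {n} {f} m≤n f≡0 = begin
  Σ< n f                ≡⟨ cong (λ l → Σ< l f) (ℕ.m∸n+n≡m m≤n) ⟨
  Σ< (n ℕ.∸ m ℕ.+ m) f  ≡⟨ padding (n ℕ.∸ m) ⟩
  Σ< m f                ∎
  where
  padding : ∀ d → Σ< (d ℕ.+ m) f ≡ Σ< m f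
  padding zero    = refl
  padding (suc d) =
    trans (cong₂ _+_ (padding d) (f≡0 (d ℕ.+ m) (ℕ.m≤n+m m d))) (+-identityʳ (Σ< m f))

Σ-reverse : ∀ n (f : ℕ → ℤ) → Σ< n f ≡ Σ[ i < n ] f (n ℕ.∸ suc i)
Σ-reverse zero    f = refl
Σ-reverse (suc n) f = begin
  Σ< n f + f n                      ≡⟨ cong (_+ f n) (Σ-reverse n f) ⟩
  Σ[ i < n ] f (n ℕ.∸ suc i) + f n  ≡⟨ +-comm _ (f n) ⟩
  f n + Σ[ i < n ] f (n ℕ.∸ suc i)  ≡⟨ Σ-uncons n (λ i → f (n ℕ.∸ i)) ⟨
  Σ[ i < suc n ] f (n ℕ.∸ i)        ∎

Σ-indicator-< : ∀ {c n} (g : ℕ → ℤ) → c ≤ n →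
  Σ[ i < n ] ((if i <ᵇ c then 1ℤ else 0ℤ) * g i) ≡ Σ< c g
Σ-indicator-< {c} g c≤n = trans (Σ-truncate c≤n beyond) (Σ-cong-< c below)
  where
  beyond : ∀ i → c ≤ i → (if i <ᵇ c then 1ℤ else 0ℤ) * g i ≡ 0ℤ
  beyond i c≤i with i <ᵇ c in eq
  ... | false = refl
  ... | true  = contradiction (ℕ.<ᵇ⇒< i c (subst T (sym eq) tt)) (ℕ.≤⇒≯ c≤i)
  below : ∀ i → i < c → (if i <ᵇ c then 1ℤ else 0ℤ) * g i ≡ g i
  below i i<c with i <ᵇ c in eq
  ... | true  = *-identityˡ (g i)
  ... | false = ⊥-elim (subst T eq (ℕ.<⇒<ᵇ i<c))

sumTo-Σ : ∀ m f → sumTo m f ≡ Σ[ i < suc m ] f i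
sumTo-Σ zero    f = sym (+-identityˡ (f 0))
sumTo-Σ (suc m) f = cong (_+ f (suc m)) (sumTo-Σ m f)

-- Formal power series

Series : Set
Series = ℕ → ℤ

infixl 6 _⊕_
infixl 7 _⊗_
infixr 8 _⊙_
infixr 9 _^_
infix 10 X+_

_⊕_ : Series → Series → Series
(F ⊕ G) n = F n + G n

_⊙_ : ℤ → Series → Series
(c ⊙ F) n = c * F n

0ₛ : Series
0ₛ _ = 0ℤ

1ₛ : Series
1ₛ zero    = 1ℤ
1ₛ (suc _) = 0ℤ

X : Series
X zero          = 0ℤ
X (suc zero)    = 1ℤ
X (suc (suc _)) = 0ℤ

X+_ : ℤ → Series
X+ c = c ⊙ 1ₛ ⊕ X

pred : Series → Series
pred F = F ⊕ -1ℤ ⊙ 1ₛ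

_⊗_ : Series → Series → Series
(F ⊗ G) zero    = F 0 * G 0
(F ⊗ G) (suc n) = F 0 * G (suc n) + (F ∘ suc ⊗ G) n

_^_ : Series → ℕ → Series
F ^ zero  = 1ₛ
F ^ suc j = F ⊗ F ^ j

Σₛ : ℕ → (ℕ → Series) → Series
Σₛ n Fs m = Σ[ i < n ] Fs i m

⊕-cong : ∀ {F F′ G G′} → F ≗ F′ → G ≗ G′ → F ⊕ G ≗ F′ ⊕ G′
⊕-cong F≗F′ G≗G′ n = cong₂ _+_ (F≗F′ n) (G≗G′ n)

⊕-congˡ : ∀ F {G G′} → G ≗ G′ → F ⊕ G ≗ F ⊕ G′
⊕-congˡ F G≗G′ n = cong (_+_ (F n)) (G≗G′ n)

⊗-congʳ : ∀ {F F′} G → F ≗ F′ → F ⊗ G ≗ F′ ⊗ G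
⊗-congʳ G F≗F′ zero    = cong (_* G 0) (F≗F′ 0)
⊗-congʳ G F≗F′ (suc n) =
  cong₂ _+_ (cong (_* G (suc n)) (F≗F′ 0)) (⊗-congʳ G (F≗F′ ∘ suc) n)

⊗-congˡ : ∀ F {G G′} → G ≗ G′ → F ⊗ G ≗ F ⊗ G′
⊗-congˡ F G≗G′ zero    = cong (F 0 *_) (G≗G′ 0)
⊗-congˡ F G≗G′ (suc n) =
  cong₂ _+_ (cong (F 0 *_) (G≗G′ (suc n))) (⊗-congˡ (F ∘ suc) G≗G′ n)

⊗-cong : ∀ {F F′ G G′} → F ≗ F′ → G ≗ G′ → F ⊗ G ≗ F′ ⊗ G′
⊗-cong {F′ = F′} {G = G} F≗F′ G≗G′ n = trans (⊗-congʳ G F≗F′ n) (⊗-congˡ F′ G≗G′ n)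

⊗-coefficient : ∀ F G n → (F ⊗ G) n ≡ Σ[ i < suc n ] (F i * G (n ℕ.∸ i))
⊗-coefficient F G zero    = sym (+-identityˡ _)
⊗-coefficient F G (suc n) = begin
  F 0 * G (suc n) + (F ∘ suc ⊗ G) n
    ≡⟨ cong (λ s → F 0 * G (suc n) + s) (⊗-coefficient (F ∘ suc) G n) ⟩
  F 0 * G (suc n) + Σ[ i < suc n ] (F (suc i) * G (n ℕ.∸ i))
    ≡⟨ Σ-uncons (suc n) (λ i → F i * G (suc n ℕ.∸ i)) ⟨
  Σ[ i < suc (suc n) ] (F i * G (suc n ℕ.∸ i)) ∎

⊗-comm : ∀ F G → F ⊗ G ≗ G ⊗ F
⊗-comm F G n = begin
  (F ⊗ G) n                                           ≡⟨ ⊗-coefficient F G n ⟩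
  Σ[ i < suc n ] (F i * G (n ℕ.∸ i))                   ≡⟨ Σ-reverse (suc n) _ ⟩
  Σ[ i < suc n ] (F (n ℕ.∸ i) * G (n ℕ.∸ (n ℕ.∸ i)))   ≡⟨ Σ-cong-< (suc n) swap ⟩
  Σ[ i < suc n ] (G i * F (n ℕ.∸ i))                   ≡⟨ ⊗-coefficient G F n ⟨
  (G ⊗ F) n                                           ∎
  where
  swap : ∀ i → i < suc n → F (n ℕ.∸ i) * G (n ℕ.∸ (n ℕ.∸ i)) ≡ G i * F (n ℕ.∸ i)
  swap i i<1+n = trans (*-comm (F (n ℕ.∸ i)) _)
                       (cong (λ l → G l * F (n ℕ.∸ i)) (ℕ.m∸[m∸n]≡n (ℕ.≤-pred i<1+n)))

⊗-distribʳ-⊕ : ∀ F G H → (F ⊕ G) ⊗ H ≗ F ⊗ H ⊕ G ⊗ H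
⊗-distribʳ-⊕ F G H zero    = *-distribʳ-+ (H 0) (F 0) (G 0)
⊗-distribʳ-⊕ F G H (suc n) = begin
  (F 0 + G 0) * H (suc n) + ((F ∘ suc ⊕ G ∘ suc) ⊗ H) n
    ≡⟨ cong₂ _+_ (*-distribʳ-+ (H (suc n)) (F 0) (G 0)) (⊗-distribʳ-⊕ (F ∘ suc) (G ∘ suc) H n) ⟩
  F 0 * H (suc n) + G 0 * H (suc n) + ((F ∘ suc ⊗ H) n + (G ∘ suc ⊗ H) n)
    ≡⟨ interchange (F 0 * H (suc n)) (G 0 * H (suc n)) _ _ ⟩
  (F ⊗ H) (suc n) + (G ⊗ H) (suc n) ∎
  where
  interchange : ∀ a b c d → a + b + (c + d) ≡ a + c + (b + d)
  interchange = solve-∀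

⊗-distribˡ-⊕ : ∀ F G H → F ⊗ (G ⊕ H) ≗ F ⊗ G ⊕ F ⊗ H
⊗-distribˡ-⊕ F G H n = begin
  (F ⊗ (G ⊕ H)) n        ≡⟨ ⊗-comm F (G ⊕ H) n ⟩
  ((G ⊕ H) ⊗ F) n        ≡⟨ ⊗-distribʳ-⊕ G H F n ⟩
  (G ⊗ F) n + (H ⊗ F) n  ≡⟨ cong₂ _+_ (⊗-comm G F n) (⊗-comm H F n) ⟩
  (F ⊗ G) n + (F ⊗ H) n  ∎

⊙-⊗-assoc : ∀ c F G → c ⊙ F ⊗ G ≗ c ⊙ (F ⊗ G)
⊙-⊗-assoc c F G zero    = *-assoc c (F 0) (G 0)
⊙-⊗-assoc c F G (suc n) =
  trans (cong₂ _+_ (*-assoc c (F 0) (G (suc n))) (⊙-⊗-assoc c (F ∘ suc) G n))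
        (sym (*-distribˡ-+ c _ _))

⊗-⊙-comm : ∀ c F G → F ⊗ c ⊙ G ≗ c ⊙ (F ⊗ G)
⊗-⊙-comm c F G n = begin
  (F ⊗ c ⊙ G) n  ≡⟨ ⊗-comm F (c ⊙ G) n ⟩
  (c ⊙ G ⊗ F) n  ≡⟨ ⊙-⊗-assoc c G F n ⟩
  c * (G ⊗ F) n  ≡⟨ cong (c *_) (⊗-comm G F n) ⟩
  c * (F ⊗ G) n  ∎

⊗-zeroʳ : ∀ F → F ⊗ 0ₛ ≗ 0ₛ
⊗-zeroʳ F zero    = *-zeroʳ (F 0)
⊗-zeroʳ F (suc n) = trans (cong₂ _+_ (*-zeroʳ (F 0)) (⊗-zeroʳ (F ∘ suc) n)) (+-identityˡ 0ℤ)

⊗-zeroˡ : ∀ F → 0ₛ ⊗ F ≗ 0ₛ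
⊗-zeroˡ F n = trans (⊗-comm 0ₛ F n) (⊗-zeroʳ F n)

⊗-identityˡ : ∀ F → 1ₛ ⊗ F ≗ F
⊗-identityˡ F zero    = *-identityˡ (F 0)
⊗-identityˡ F (suc n) = trans (cong₂ _+_ (*-identityˡ (F (suc n))) (⊗-zeroˡ F n)) (+-identityʳ _)

⊗-identityʳ : ∀ F → F ⊗ 1ₛ ≗ F
⊗-identityʳ F n = trans (⊗-comm F 1ₛ n) (⊗-identityˡ F n)

X⊗-suc : ∀ F n → (X ⊗ F) (suc n) ≡ F n
X⊗-suc F n = trans (+-identityˡ _) (trans (⊗-congʳ F X∘suc≗1 n) (⊗-identityˡ F n))
  where
  X∘suc≗1 : X ∘ suc ≗ 1ₛ
  X∘suc≗1 zero    = refl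
  X∘suc≗1 (suc n) = refl

⊗-assoc : ∀ F G H → (F ⊗ G) ⊗ H ≗ F ⊗ (G ⊗ H)
⊗-assoc F G H zero    = *-assoc (F 0) (G 0) (H 0)
⊗-assoc F G H (suc n) = begin
  F 0 * G 0 * H (suc n) + ((F 0 ⊙ G ∘ suc ⊕ F ∘ suc ⊗ G) ⊗ H) n
    ≡⟨ cong (λ s → F 0 * G 0 * H (suc n) + s) (⊗-distribʳ-⊕ (F 0 ⊙ G ∘ suc) (F ∘ suc ⊗ G) H n) ⟩
  F 0 * G 0 * H (suc n) + ((F 0 ⊙ G ∘ suc ⊗ H) n + ((F ∘ suc ⊗ G) ⊗ H) n)
    ≡⟨ cong (λ s → F 0 * G 0 * H (suc n) + s)
            (cong₂ _+_ (⊙-⊗-assoc (F 0) (G ∘ suc) H n) (⊗-assoc (F ∘ suc) G H n)) ⟩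
  F 0 * G 0 * H (suc n) + (F 0 * (G ∘ suc ⊗ H) n + (F ∘ suc ⊗ (G ⊗ H)) n)
    ≡⟨ regroup (F 0) (G 0) (H (suc n)) _ _ ⟩
  F 0 * (G 0 * H (suc n) + (G ∘ suc ⊗ H) n) + (F ∘ suc ⊗ (G ⊗ H)) n ∎
  where
  regroup : ∀ a b c d e → a * b * c + (a * d + e) ≡ a * (b * c + d) + e
  regroup = solve-∀

⊗-leftComm : ∀ F G H → F ⊗ (G ⊗ H) ≗ G ⊗ (F ⊗ H)
⊗-leftComm F G H n = begin
  (F ⊗ (G ⊗ H)) n  ≡⟨ ⊗-assoc F G H n ⟨
  (F ⊗ G ⊗ H) n    ≡⟨ ⊗-congʳ H (⊗-comm F G) n ⟩
  (G ⊗ F ⊗ H) n    ≡⟨ ⊗-assoc G F H n ⟩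
  (G ⊗ (F ⊗ H)) n  ∎

⊗-distribˡ-Σₛ : ∀ F n Gs → F ⊗ Σₛ n Gs ≗ Σₛ n (λ i → F ⊗ Gs i)
⊗-distribˡ-Σₛ F zero    Gs m = ⊗-zeroʳ F m
⊗-distribˡ-Σₛ F (suc n) Gs m =
  trans (⊗-distribˡ-⊕ F (Σₛ n Gs) (Gs n) m) (cong (_+ (F ⊗ Gs n) m) (⊗-distribˡ-Σₛ F n Gs m))

^-cong : ∀ {F G} j → F ≗ G → F ^ j ≗ G ^ j
^-cong zero    F≗G = λ _ → refl
^-cong (suc j) F≗G = ⊗-cong F≗G (^-cong j F≗G)

^-+ : ∀ F a b → F ^ (a ℕ.+ b) ≗ F ^ a ⊗ F ^ b
^-+ F zero    b n = sym (⊗-identityˡ (F ^ b) n)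
^-+ F (suc a) b n = trans (⊗-congˡ F (^-+ F a b) n) (sym (⊗-assoc F (F ^ a) (F ^ b) n))

^-* : ∀ F a b → (F ^ a) ^ b ≗ F ^ (a ℕ.* b)
^-* F a zero    n rewrite ℕ.*-zeroʳ a = refl
^-* F a (suc b) n rewrite ℕ.*-suc a b =
  trans (⊗-congˡ (F ^ a) (^-* F a b) n) (sym (^-+ F a (a ℕ.* b) n))

^-distrib-⊗ : ∀ F G j → (F ⊗ G) ^ j ≗ F ^ j ⊗ G ^ j
^-distrib-⊗ F G zero    n = sym (⊗-identityˡ 1ₛ n)
^-distrib-⊗ F G (suc j) n = begin
  (F ⊗ G ⊗ (F ⊗ G) ^ j) n        ≡⟨ ⊗-congˡ (F ⊗ G) (^-distrib-⊗ F G j) n ⟩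
  (F ⊗ G ⊗ (F ^ j ⊗ G ^ j)) n    ≡⟨ ⊗-assoc F G _ n ⟩
  (F ⊗ (G ⊗ (F ^ j ⊗ G ^ j))) n  ≡⟨ ⊗-congˡ F (⊗-leftComm G (F ^ j) (G ^ j)) n ⟩
  (F ⊗ (F ^ j ⊗ (G ⊗ G ^ j))) n  ≡⟨ ⊗-assoc F (F ^ j) _ n ⟨
  (F ^ suc j ⊗ G ^ suc j) n      ∎

X+⊗ : ∀ c F → X+ c ⊗ F ≗ c ⊙ F ⊕ X ⊗ F
X+⊗ c F n = begin
  (X+ c ⊗ F) n                ≡⟨ ⊗-distribʳ-⊕ (c ⊙ 1ₛ) X F n ⟩
  (c ⊙ 1ₛ ⊗ F) n + (X ⊗ F) n  ≡⟨ cong (_+ (X ⊗ F) n) (⊙-⊗-assoc c 1ₛ F n) ⟩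
  c * (1ₛ ⊗ F) n + (X ⊗ F) n  ≡⟨ cong (λ s → c * s + (X ⊗ F) n) (⊗-identityˡ F n) ⟩
  c * F n + (X ⊗ F) n         ∎

pred-⊗ : ∀ P F m → (pred P ⊗ F) m ≡ (P ⊗ F) m - F m
pred-⊗ P F m = begin
  (pred P ⊗ F) m                 ≡⟨ ⊗-distribʳ-⊕ P (-1ℤ ⊙ 1ₛ) F m ⟩
  (P ⊗ F) m + (-1ℤ ⊙ 1ₛ ⊗ F) m   ≡⟨ cong (λ s → (P ⊗ F) m + s) (⊙-⊗-assoc -1ℤ 1ₛ F m) ⟩
  (P ⊗ F) m + -1ℤ * (1ₛ ⊗ F) m   ≡⟨ cong (λ s → (P ⊗ F) m + -1ℤ * s) (⊗-identityˡ F m) ⟩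
  (P ⊗ F) m + -1ℤ * F m          ≡⟨ cong (λ s → (P ⊗ F) m + s) (-1*i≡-i (F m)) ⟩
  (P ⊗ F) m - F m                ∎

X^-coefficient : ∀ d p → (X ^ d) p ≡ (if d ≡ᵇ p then 1ℤ else 0ℤ)
X^-coefficient zero    zero    = refl
X^-coefficient zero    (suc p) = refl
X^-coefficient (suc d) zero    = refl
X^-coefficient (suc d) (suc p) = trans (X⊗-suc (X ^ d) p) (X^-coefficient d p)

Σ-X^-coefficient : ∀ n (c : ℕ → ℤ) p → (∀ i → n ≤ i → c i ≡ 0ℤ) →
  Σ[ i < n ] (c i * (X ^ i) p) ≡ c p
Σ-X^-coefficient zero    c p       c≡0 = sym (c≡0 p z≤n)
Σ-X^-coefficient (suc n) c zero    c≡0 = begin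
  Σ[ i < suc n ] (c i * (X ^ i) 0)        ≡⟨ Σ-uncons n _ ⟩
  c 0 * 1ℤ + Σ[ i < n ] (c (suc i) * 0ℤ)  ≡⟨ cong₂ _+_ (*-identityʳ (c 0))
                                                       (Σ-zero n (λ i _ → *-zeroʳ (c (suc i)))) ⟩
  c 0 + 0ℤ                                ≡⟨ +-identityʳ (c 0) ⟩
  c 0                                     ∎
Σ-X^-coefficient (suc n) c (suc p) c≡0 = begin
  Σ[ i < suc n ] (c i * (X ^ i) (suc p))
    ≡⟨ Σ-uncons n _ ⟩
  c 0 * 0ℤ + Σ[ i < n ] (c (suc i) * (X ⊗ X ^ i) (suc p))
    ≡⟨ cong₂ _+_ (*-zeroʳ (c 0)) (Σ-cong n (λ i → cong (c (suc i) *_) (X⊗-suc (X ^ i) p))) ⟩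
  0ℤ + Σ[ i < n ] (c (suc i) * (X ^ i) p)
    ≡⟨ +-identityˡ _ ⟩
  Σ[ i < n ] (c (suc i) * (X ^ i) p)
    ≡⟨ Σ-X^-coefficient n (c ∘ suc) p (λ i n≤i → c≡0 (suc i) (s≤s n≤i)) ⟩
  c (suc p) ∎

weighted-pascal : ∀ c j m →
  c ℕ.* (c ℕ.^ (j ℕ.∸ suc m) ℕ.* (j C suc m)) ℕ.+ c ℕ.^ (j ℕ.∸ m) ℕ.* (j C m)
  ≡ c ℕ.^ (j ℕ.∸ m) ℕ.* (suc j C suc m)
weighted-pascal c j m = begin
  c ℕ.* (c ℕ.^ (j ℕ.∸ suc m) ℕ.* (j C suc m)) ℕ.+ c ℕ.^ (j ℕ.∸ m) ℕ.* (j C m)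
    ≡⟨ cong (ℕ._+ c ℕ.^ (j ℕ.∸ m) ℕ.* (j C m)) absorb ⟩
  c ℕ.^ (j ℕ.∸ m) ℕ.* (j C suc m) ℕ.+ c ℕ.^ (j ℕ.∸ m) ℕ.* (j C m)
    ≡⟨ ℕ.*-distribˡ-+ (c ℕ.^ (j ℕ.∸ m)) (j C suc m) (j C m) ⟨
  c ℕ.^ (j ℕ.∸ m) ℕ.* (j C suc m ℕ.+ j C m)
    ≡⟨ cong (c ℕ.^ (j ℕ.∸ m) ℕ.*_)
            (trans (ℕ.+-comm (j C suc m) (j C m)) (nCk+nC[k+1]≡[n+1]C[k+1] j m)) ⟩
  c ℕ.^ (j ℕ.∸ m) ℕ.* (suc j C suc m) ∎
  where
  absorb : c ℕ.* (c ℕ.^ (j ℕ.∸ suc m) ℕ.* (j C suc m)) ≡ c ℕ.^ (j ℕ.∸ m) ℕ.* (j C suc m)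
  absorb with m ℕ.<? j
  ... | yes m<j = begin
    c ℕ.* (c ℕ.^ (j ℕ.∸ suc m) ℕ.* (j C suc m))  ≡⟨ ℕ.*-assoc c _ _ ⟨
    c ℕ.^ suc (j ℕ.∸ suc m) ℕ.* (j C suc m)      ≡⟨ cong (λ e → c ℕ.^ e ℕ.* (j C suc m))
                                                          (ℕ.+-∸-assoc 1 m<j) ⟨
    c ℕ.^ (j ℕ.∸ m) ℕ.* (j C suc m)              ∎
  ... | no m≮j rewrite k>n⇒nCk≡0 (ℕ.≰⇒> m≮j) =
    trans (cong (c ℕ.*_) (ℕ.*-zeroʳ (c ℕ.^ (j ℕ.∸ suc m))))
          (trans (ℕ.*-zeroʳ c) (sym (ℕ.*-zeroʳ (c ℕ.^ (j ℕ.∸ m)))))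

X+^-coefficient : ∀ c j m → (X+ (+ c) ^ j) m ≡ + (c ℕ.^ (j ℕ.∸ m) ℕ.* (j C m))
X+^-coefficient c zero    zero    = refl
X+^-coefficient c zero    (suc m) = refl
X+^-coefficient c (suc j) zero    = begin
  (X+ (+ c) ⊗ X+ (+ c) ^ j) 0   ≡⟨ X+⊗ (+ c) (X+ (+ c) ^ j) 0 ⟩
  + c * (X+ (+ c) ^ j) 0 + 0ℤ   ≡⟨ +-identityʳ _ ⟩
  + c * (X+ (+ c) ^ j) 0        ≡⟨ cong (+ c *_) (X+^-coefficient c j 0) ⟩
  + c * + (c ℕ.^ j ℕ.* 1)       ≡⟨ pos-* c _ ⟨
  + (c ℕ.* (c ℕ.^ j ℕ.* 1))     ≡⟨ cong +_ (ℕ.*-assoc c _ 1) ⟨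
  + (c ℕ.^ suc j ℕ.* 1)         ∎
X+^-coefficient c (suc j) (suc m) = begin
  (X+ (+ c) ⊗ X+ (+ c) ^ j) (suc m)
    ≡⟨ X+⊗ (+ c) _ (suc m) ⟩
  + c * (X+ (+ c) ^ j) (suc m) + (X ⊗ X+ (+ c) ^ j) (suc m)
    ≡⟨ cong₂ _+_ (cong (+ c *_) (X+^-coefficient c j (suc m)))
                 (trans (X⊗-suc _ m) (X+^-coefficient c j m)) ⟩
  + c * + a + + b
    ≡⟨ trans (pos-+ (c ℕ.* a) b) (cong (_+ + b) (pos-* c a)) ⟨
  + (c ℕ.* a ℕ.+ b)
    ≡⟨ cong +_ (weighted-pascal c j m) ⟩
  + (c ℕ.^ (j ℕ.∸ m) ℕ.* (suc j C suc m)) ∎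
  where
  a b : ℕ
  a = c ℕ.^ (j ℕ.∸ suc m) ℕ.* (j C suc m)
  b = c ℕ.^ (j ℕ.∸ m) ℕ.* (j C m)

X+1^-coefficient : ∀ N m → (X+ (+ 1) ^ N) m ≡ + (N C m)
X+1^-coefficient N m = trans (X+^-coefficient 1 N m)
  (cong +_ (trans (cong (ℕ._* (N C m)) (ℕ.^-zeroˡ (N ℕ.∸ m))) (ℕ.*-identityˡ (N C m))))

-- The coefficients of (t − 1) · Σᵢ bᵢ tⁱ.
Δ : (ℕ → ℤ) → ℕ → ℤ
Δ b zero    = - b 0
Δ b (suc i) = b i - b (suc i)

summation-by-parts : ∀ n (b π : ℕ → ℤ) →
  Σ[ i < n ] (b i * (π (suc i) - π i)) ≡ Σ[ i < suc n ] (Δ b i * π i) + b n * π n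
summation-by-parts zero    b π = boundary (b 0) (π 0)
  where
  boundary : ∀ b₀ π₀ → 0ℤ ≡ 0ℤ + - b₀ * π₀ + b₀ * π₀
  boundary = solve-∀
summation-by-parts (suc n) b π =
  trans (cong (_+ b n * (π (suc n) - π n)) (summation-by-parts n b π))
        (step (Σ[ i < suc n ] (Δ b i * π i)) (b n) (b (suc n)) (π n) (π (suc n)))
  where
  step : ∀ s bₙ bₙ₊₁ πₙ πₙ₊₁ →
    s + bₙ * πₙ + bₙ * (πₙ₊₁ - πₙ) ≡ s + (bₙ - bₙ₊₁) * πₙ₊₁ + bₙ₊₁ * πₙ₊₁
  step = solve-∀

pred-⊗-polynomial : ∀ P n b → b n ≡ 0ℤ →
  pred P ⊗ Σₛ n (λ i → b i ⊙ P ^ i) ≗ Σₛ (suc n) (λ i → Δ b i ⊙ P ^ i)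
pred-⊗-polynomial P n b bₙ≡0 m = begin
  (pred P ⊗ Σₛ n (λ i → b i ⊙ P ^ i)) m
    ≡⟨ ⊗-distribˡ-Σₛ (pred P) n _ m ⟩
  Σ[ i < n ] (pred P ⊗ b i ⊙ P ^ i) m
    ≡⟨ Σ-cong n (λ i → trans (⊗-⊙-comm (b i) _ (P ^ i) m) (cong (b i *_) (pred-⊗ P (P ^ i) m))) ⟩
  Σ[ i < n ] (b i * ((P ^ suc i) m - (P ^ i) m))
    ≡⟨ summation-by-parts n b (λ i → (P ^ i) m) ⟩
  Σ[ i < suc n ] (Δ b i * (P ^ i) m) + b n * (P ^ n) m
    ≡⟨ cong (λ c → Σ[ i < suc n ] (Δ b i * (P ^ i) m) + c * (P ^ n) m) bₙ≡0 ⟩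
  Σ[ i < suc n ] (Δ b i * (P ^ i) m) + 0ℤ
    ≡⟨ +-identityʳ _ ⟩
  Σ[ i < suc n ] (Δ b i * (P ^ i) m) ∎

sign-suc : ∀ e → sign (suc e) ≡ - sign e
sign-suc e with isEven e
... | true  = refl
... | false = refl

sign-suc-suc : ∀ e → sign (suc (suc e)) ≡ sign e
sign-suc-suc e with isEven e
... | true  = refl
... | false = refl

sign-+ : ∀ a b → sign (a ℕ.+ b) ≡ sign a * sign b
sign-+ zero    b = sym (*-identityˡ (sign b))
sign-+ (suc a) b = begin
  sign (suc (a ℕ.+ b))   ≡⟨ sign-suc (a ℕ.+ b) ⟩
  - sign (a ℕ.+ b)       ≡⟨ cong -_ (sign-+ a b) ⟩
  - (sign a * sign b)    ≡⟨ neg-distribˡ-* (sign a) (sign b) ⟩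
  - sign a * sign b      ≡⟨ cong (_* sign b) (sign-suc a) ⟨
  sign (suc a) * sign b  ∎

signedBinomial : ℕ → ℕ → ℤ
signedBinomial j i = sign (j ℕ.+ i) * + (j C i)

signedBinomial-vanishes : ∀ {j i} → j < i → signedBinomial j i ≡ 0ℤ
signedBinomial-vanishes {j} {i} j<i =
  trans (cong (λ b → sign (j ℕ.+ i) * + b) (k>n⇒nCk≡0 j<i)) (*-zeroʳ (sign (j ℕ.+ i)))

Δ-signedBinomial : ∀ j i → Δ (signedBinomial j) i ≡ signedBinomial (suc j) i
Δ-signedBinomial j zero    = begin
  - (sign (j ℕ.+ 0) * 1ℤ)  ≡⟨ neg-distribˡ-* (sign (j ℕ.+ 0)) 1ℤ ⟩
  - sign (j ℕ.+ 0) * 1ℤ    ≡⟨ cong (_* 1ℤ) (sign-suc (j ℕ.+ 0)) ⟨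
  sign (suc j ℕ.+ 0) * 1ℤ  ∎
Δ-signedBinomial j (suc i) = begin
  s * + (j C i) - sign (j ℕ.+ suc i) * + (j C suc i)
    ≡⟨ cong (λ e → s * + (j C i) - sign e * + (j C suc i)) (ℕ.+-suc j i) ⟩
  s * + (j C i) - sign (suc (j ℕ.+ i)) * + (j C suc i)
    ≡⟨ cong (λ t → s * + (j C i) - t * + (j C suc i)) (sign-suc (j ℕ.+ i)) ⟩
  s * + (j C i) - - s * + (j C suc i)
    ≡⟨ factor s (+ (j C i)) (+ (j C suc i)) ⟩
  s * (+ (j C i) + + (j C suc i))
    ≡⟨ cong (s *_) (trans (sym (pos-+ (j C i) (j C suc i))) (cong +_ (nCk+nC[k+1]≡[n+1]C[k+1] j i))) ⟩
  s * + (suc j C suc i)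
    ≡⟨ cong (_* + (suc j C suc i)) (trans (cong (sign ∘ suc) (ℕ.+-suc j i)) (sign-suc-suc (j ℕ.+ i))) ⟨
  sign (suc j ℕ.+ suc i) * + (suc j C suc i) ∎
  where
  s : ℤ
  s = sign (j ℕ.+ i)
  factor : ∀ s a b → s * a - - s * b ≡ s * (a + b)
  factor = solve-∀

binomial-pred : ∀ P j → pred P ^ j ≗ Σₛ (suc j) (λ i → signedBinomial j i ⊙ P ^ i)
binomial-pred P zero    m = sym (trans (+-identityˡ _) (*-identityˡ (1ₛ m)))
binomial-pred P (suc j) m = begin
  (pred P ⊗ pred P ^ j) m
    ≡⟨ ⊗-congˡ (pred P) (binomial-pred P j) m ⟩
  (pred P ⊗ Σₛ (suc j) (λ i → signedBinomial j i ⊙ P ^ i)) m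
    ≡⟨ pred-⊗-polynomial P (suc j) (signedBinomial j) (signedBinomial-vanishes (ℕ.n<1+n j)) m ⟩
  Σ[ i < suc (suc j) ] (Δ (signedBinomial j) i * (P ^ i) m)
    ≡⟨ Σ-cong (suc (suc j)) (λ i → cong (_* (P ^ i) m) (Δ-signedBinomial j i)) ⟩
  Σ[ i < suc (suc j) ] (signedBinomial (suc j) i * (P ^ i) m) ∎

X-1^-coefficient : ∀ m p → (pred X ^ m) p ≡ signedBinomial m p
X-1^-coefficient m p = trans (binomial-pred X m p)
  (Σ-X^-coefficient (suc m) (signedBinomial m) p (λ i m<i → signedBinomial-vanishes m<i))

-- The generating function of blocks

-- blockSeries c counts the blocks over [c] by length: a block starting with a is a alone, or,
-- when a is even, a followed by a block over [a − 1].
blockSeries   : ℕ → Series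
continuations : ℕ → Series

blockSeries zero    = 0ₛ
blockSeries (suc c) = blockSeries c ⊕ X ⊗ (1ₛ ⊕ continuations c)

continuations c = if isEven (suc c) then blockSeries c else 0ₛ

blockSeries-constant : ∀ c → blockSeries c 0 ≡ 0ℤ
blockSeries-constant zero    = refl
blockSeries-constant (suc c) = trans (+-identityʳ _) (blockSeries-constant c)

continuations-constant : ∀ c → continuations c 0 ≡ 0ℤ
continuations-constant c with isEven (suc c)
... | true  = blockSeries-constant c
... | false = refl

blockSeries-suc-⊗ : ∀ c G n →
  (blockSeries (suc c) ⊗ G) (suc n) ≡ (blockSeries c ⊗ G) (suc n) + (G n + (continuations c ⊗ G) n)
blockSeries-suc-⊗ c G n =
  trans (⊗-distribʳ-⊕ (blockSeries c) (X ⊗ (1ₛ ⊕ continuations c)) G (suc n))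
        (cong (_+_ ((blockSeries c ⊗ G) (suc n))) new-blocks)
  where
  new-blocks : (X ⊗ (1ₛ ⊕ continuations c) ⊗ G) (suc n) ≡ G n + (continuations c ⊗ G) n
  new-blocks = begin
    (X ⊗ (1ₛ ⊕ continuations c) ⊗ G) (suc n)    ≡⟨ ⊗-assoc X _ G (suc n) ⟩
    (X ⊗ ((1ₛ ⊕ continuations c) ⊗ G)) (suc n)  ≡⟨ X⊗-suc _ n ⟩
    ((1ₛ ⊕ continuations c) ⊗ G) n              ≡⟨ ⊗-distribʳ-⊕ 1ₛ (continuations c) G n ⟩
    (1ₛ ⊗ G) n + (continuations c ⊗ G) n        ≡⟨ cong (_+ (continuations c ⊗ G) n) (⊗-identityˡ G n) ⟩
    G n + (continuations c ⊗ G) n               ∎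

isEven-double : ∀ r → isEven (2 ℕ.* r) ≡ true
isEven-double zero    = refl
isEven-double (suc r) = trans (cong isEven (ℕ.*-suc 2 r)) (cong (not ∘ not) (isEven-double r))

blockSeries-double-suc : ∀ r →
  blockSeries (2 ℕ.* suc r) ≗ blockSeries (2 ℕ.* r) ⊕ X ⊗ (X+ (+ 2) ⊕ blockSeries (2 ℕ.* r))
blockSeries-double-suc r m = begin
  blockSeries (2 ℕ.* suc r) m            ≡⟨ cong (λ c → blockSeries c m) (ℕ.*-suc 2 r) ⟩
  blockSeries (suc (suc (2 ℕ.* r))) m    ≡⟨ unfold m ⟩
  (B₁ ⊕ X ⊗ (1ₛ ⊕ B₁)) m                 ≡⟨ ⊕-cong odd (⊗-congˡ X (⊕-congˡ 1ₛ odd)) m ⟩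
  (B ⊕ X ⊕ X ⊗ (1ₛ ⊕ (B ⊕ X))) m         ≡⟨ +-assoc (B m) (X m) _ ⟩
  B m + (X m + (X ⊗ (1ₛ ⊕ (B ⊕ X))) m)   ≡⟨ cong (_+_ (B m)) two-letters ⟩
  (B ⊕ X ⊗ (X+ (+ 2) ⊕ B)) m             ∎
  where
  B B₁ : Series
  B  = blockSeries (2 ℕ.* r)
  B₁ = blockSeries (suc (2 ℕ.* r))
  unfold : blockSeries (suc (suc (2 ℕ.* r))) ≗ B₁ ⊕ X ⊗ (1ₛ ⊕ B₁)
  unfold m rewrite isEven-double r = refl
  odd : B₁ ≗ B ⊕ X
  odd m rewrite isEven-double r =
    cong (_+_ (B m)) (trans (⊗-congˡ X (λ i → +-identityʳ (1ₛ i)) m) (⊗-identityʳ X m))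
  two-letters : X m + (X ⊗ (1ₛ ⊕ (B ⊕ X))) m ≡ (X ⊗ (X+ (+ 2) ⊕ B)) m
  two-letters = begin
    X m + (X ⊗ (1ₛ ⊕ (B ⊕ X))) m         ≡⟨ cong (_+ (X ⊗ (1ₛ ⊕ (B ⊕ X))) m) (⊗-identityʳ X m) ⟨
    (X ⊗ 1ₛ) m + (X ⊗ (1ₛ ⊕ (B ⊕ X))) m  ≡⟨ ⊗-distribˡ-⊕ X 1ₛ _ m ⟨
    (X ⊗ (1ₛ ⊕ (1ₛ ⊕ (B ⊕ X)))) m        ≡⟨ ⊗-congˡ X (λ i → regroup (1ₛ i) (B i) (X i)) m ⟩
    (X ⊗ (X+ (+ 2) ⊕ B)) m               ∎
    where
    regroup : ∀ o b x → o + (o + (b + x)) ≡ + 2 * o + x + b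
    regroup = solve-∀

⊗-pred-X+1⊗ : ∀ A P → A ⊗ pred P ⊕ X ⊗ (A ⊕ A ⊗ pred P) ≗ A ⊗ pred (X+ (+ 1) ⊗ P)
⊗-pred-X+1⊗ A P m = begin
  (A ⊗ pred P ⊕ X ⊗ (A ⊕ A ⊗ pred P)) m  ≡⟨ ⊕-congˡ (A ⊗ pred P) (⊗-congˡ X A⊕A⊗predP) m ⟩
  (A ⊗ pred P ⊕ X ⊗ (A ⊗ P)) m           ≡⟨ ⊕-congˡ (A ⊗ pred P) (⊗-leftComm X A P) m ⟩
  (A ⊗ pred P ⊕ A ⊗ (X ⊗ P)) m           ≡⟨ ⊗-distribˡ-⊕ A (pred P) (X ⊗ P) m ⟨
  (A ⊗ (pred P ⊕ X ⊗ P)) m               ≡⟨ ⊗-congˡ A predP⊕X⊗P m ⟩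
  (A ⊗ pred (X+ (+ 1) ⊗ P)) m            ∎
  where
  A⊕A⊗predP : A ⊕ A ⊗ pred P ≗ A ⊗ P
  A⊕A⊗predP i = begin
    A i + (A ⊗ pred P) i         ≡⟨ cong (_+ (A ⊗ pred P) i) (⊗-identityʳ A i) ⟨
    (A ⊗ 1ₛ) i + (A ⊗ pred P) i  ≡⟨ ⊗-distribˡ-⊕ A 1ₛ (pred P) i ⟨
    (A ⊗ (1ₛ ⊕ pred P)) i        ≡⟨ ⊗-congˡ A (λ l → cancel (1ₛ l) (P l)) i ⟩
    (A ⊗ P) i                    ∎
    where
    cancel : ∀ o p → o + (p + -1ℤ * o) ≡ p
    cancel = solve-∀
  predP⊕X⊗P : pred P ⊕ X ⊗ P ≗ pred (X+ (+ 1) ⊗ P)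
  predP⊕X⊗P i = begin
    P i + -1ℤ * 1ₛ i + (X ⊗ P) i        ≡⟨ regroup (P i) (1ₛ i) ((X ⊗ P) i) ⟩
    + 1 * P i + (X ⊗ P) i + -1ℤ * 1ₛ i  ≡⟨ cong (_+ -1ℤ * 1ₛ i) (X+⊗ (+ 1) P i) ⟨
    (X+ (+ 1) ⊗ P) i + -1ℤ * 1ₛ i       ∎
    where
    regroup : ∀ p o x → p + -1ℤ * o + x ≡ + 1 * p + x + -1ℤ * o
    regroup = solve-∀

blockSeries-closed : ∀ r → blockSeries (2 ℕ.* r) ≗ X+ (+ 2) ⊗ pred (X+ (+ 1) ^ r)
blockSeries-closed zero    m = sym (trans (⊗-congˡ (X+ (+ 2)) cancel m) (⊗-zeroʳ (X+ (+ 2)) m))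
  where
  cancel : pred 1ₛ ≗ 0ₛ
  cancel zero    = refl
  cancel (suc _) = refl
blockSeries-closed (suc r) m = begin
  blockSeries (2 ℕ.* suc r) m
    ≡⟨ blockSeries-double-suc r m ⟩
  (blockSeries (2 ℕ.* r) ⊕ X ⊗ (X+ (+ 2) ⊕ blockSeries (2 ℕ.* r))) m
    ≡⟨ ⊕-cong IH (⊗-congˡ X (⊕-congˡ (X+ (+ 2)) IH)) m ⟩
  (X+ (+ 2) ⊗ pred P ⊕ X ⊗ (X+ (+ 2) ⊕ X+ (+ 2) ⊗ pred P)) m
    ≡⟨ ⊗-pred-X+1⊗ (X+ (+ 2)) P m ⟩
  (X+ (+ 2) ⊗ pred (X+ (+ 1) ^ suc r)) m ∎
  where
  P : Series
  P = X+ (+ 1) ^ r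
  IH : blockSeries (2 ℕ.* r) ≗ X+ (+ 2) ⊗ pred P
  IH = blockSeries-closed r

blockSeries-^-coefficient : ∀ k j n → (blockSeries (2 ℕ.* k) ^ j) n ≡
  Σ[ i₁ < suc n ] (+ (2 ℕ.^ (j ℕ.∸ i₁) ℕ.* (j C i₁)) *
                   Σ[ i₂ < suc j ] (signedBinomial j i₂ * + ((k ℕ.* i₂) C (n ℕ.∸ i₁))))
blockSeries-^-coefficient k j n = begin
  (blockSeries (2 ℕ.* k) ^ j) n                      ≡⟨ ^-cong j (blockSeries-closed k) n ⟩
  ((A ⊗ M) ^ j) n                                    ≡⟨ ^-distrib-⊗ A M j n ⟩
  (A ^ j ⊗ M ^ j) n                                  ≡⟨ ⊗-coefficient (A ^ j) (M ^ j) n ⟩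
  Σ[ i₁ < suc n ] ((A ^ j) i₁ * (M ^ j) (n ℕ.∸ i₁))
    ≡⟨ Σ-cong (suc n) (λ i₁ → cong₂ _*_ (X+^-coefficient 2 j i₁) (M^j-coefficient (n ℕ.∸ i₁))) ⟩
  Σ[ i₁ < suc n ] (+ (2 ℕ.^ (j ℕ.∸ i₁) ℕ.* (j C i₁)) *
                   Σ[ i₂ < suc j ] (signedBinomial j i₂ * + ((k ℕ.* i₂) C (n ℕ.∸ i₁)))) ∎
  where
  A M : Series
  A = X+ (+ 2)
  M = pred (X+ (+ 1) ^ k)
  M^j-coefficient : ∀ m → (M ^ j) m ≡ Σ[ i₂ < suc j ] (signedBinomial j i₂ * + ((k ℕ.* i₂) C m))
  M^j-coefficient m = trans (binomial-pred (X+ (+ 1) ^ k) j m) (Σ-cong (suc j) (λ i₂ →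
    cong (signedBinomial j i₂ *_) (trans (^-* (X+ (+ 1)) k i₂ m) (X+1^-coefficient (k ℕ.* i₂) m))))

sumWords : ℕ → ℕ → (List ℕ → ℤ) → ℤ
sumWords N zero    f = f []
sumWords N (suc n) f = Σ[ i < N ] sumWords N n (λ w → f (suc i ∷ w))

length-filterᵇ-++ : ∀ {A : Set} (P : A → Bool) xs ys →
  length (filterᵇ P (xs ++ ys)) ≡ length (filterᵇ P xs) ℕ.+ length (filterᵇ P ys)
length-filterᵇ-++ P xs ys = trans (cong length (filter-++ (T? ∘ P) xs ys)) (length-++ (filterᵇ P xs))

length-filterᵇ-map : ∀ {A B : Set} (P : B → Bool) (f : A → B) xs →
  length (filterᵇ P (map f xs)) ≡ length (filterᵇ (P ∘ f) xs)
length-filterᵇ-map P f []       = refl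
length-filterᵇ-map P f (x ∷ xs) with P (f x)
... | true  = cong suc (length-filterᵇ-map P f xs)
... | false = length-filterᵇ-map P f xs

length-filterᵇ-concatMap : ∀ {A : Set} (P : A → Bool) (g : ℕ → List A) f n →
  + length (filterᵇ P (concatMap g (applyUpTo f n))) ≡ Σ[ i < n ] (+ length (filterᵇ P (g (f i))))
length-filterᵇ-concatMap P g f zero    = refl
length-filterᵇ-concatMap {A} P g f (suc n) = begin
  + length (filterᵇ P (g (f 0) ++ rest))
    ≡⟨ cong +_ (length-filterᵇ-++ P (g (f 0)) rest) ⟩
  + (length (filterᵇ P (g (f 0))) ℕ.+ length (filterᵇ P rest))
    ≡⟨ pos-+ (length (filterᵇ P (g (f 0)))) _ ⟩
  + length (filterᵇ P (g (f 0))) + + length (filterᵇ P rest)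
    ≡⟨ cong (_+_ (+ length (filterᵇ P (g (f 0))))) (length-filterᵇ-concatMap P g (f ∘ suc) n) ⟩
  + length (filterᵇ P (g (f 0))) + Σ[ i < n ] (+ length (filterᵇ P (g (f (suc i)))))
    ≡⟨ Σ-uncons n (λ i → + length (filterᵇ P (g (f i)))) ⟨
  Σ[ i < suc n ] (+ length (filterᵇ P (g (f i)))) ∎
  where
  rest : List A
  rest = concatMap g (applyUpTo (f ∘ suc) n)

countWords-sumWords : ∀ N n P → + countWords N n P ≡ sumWords N n (λ w → if P w then 1ℤ else 0ℤ)
countWords-sumWords N zero    P with P []
... | true  = refl
... | false = refl
countWords-sumWords N (suc n) P = begin
  + length (filterᵇ P (concatMap (λ a → map (a ∷_) (words N n)) (map suc (upTo N))))
    ≡⟨ cong (λ ws → + length (filterᵇ P ws)) (concatMap-map (λ a → map (a ∷_) (words N n)) suc (upTo N)) ⟩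
  + length (filterᵇ P (concatMap (λ i → map (suc i ∷_) (words N n)) (upTo N)))
    ≡⟨ length-filterᵇ-concatMap P (λ i → map (suc i ∷_) (words N n)) id N ⟩
  Σ[ i < N ] (+ length (filterᵇ P (map (suc i ∷_) (words N n))))
    ≡⟨ Σ-cong N (λ i → cong +_ (length-filterᵇ-map P (suc i ∷_) (words N n))) ⟩
  Σ[ i < N ] (+ countWords N n (λ w → P (suc i ∷ w)))
    ≡⟨ Σ-cong N (λ i → countWords-sumWords N n (λ w → P (suc i ∷ w))) ⟩
  sumWords N (suc n) (λ w → if P w then 1ℤ else 0ℤ) ∎

sumWords-cong : ∀ N n {f g : List ℕ → ℤ} →
  (∀ w → length w ≡ n → All (_≤ N) w → f w ≡ g w) → sumWords N n f ≡ sumWords N n g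
sumWords-cong N zero    f≡g = f≡g [] refl []
sumWords-cong N (suc n) f≡g = Σ-cong-< N (λ i i<N →
  sumWords-cong N n (λ w |w|≡n w≤N → f≡g (suc i ∷ w) (cong suc |w|≡n) (i<N ∷ w≤N)))

sumWords-zero : ∀ N n {f : List ℕ → ℤ} → (∀ w → f w ≡ 0ℤ) → sumWords N n f ≡ 0ℤ
sumWords-zero N zero    f≡0 = f≡0 []
sumWords-zero N (suc n) f≡0 = Σ-zero N (λ i _ → sumWords-zero N n (λ w → f≡0 (suc i ∷ w)))

sumWords-distrib-+ : ∀ N n (f g : List ℕ → ℤ) →
  sumWords N n (λ w → f w + g w) ≡ sumWords N n f + sumWords N n g
sumWords-distrib-+ N zero    f g = refl
sumWords-distrib-+ N (suc n) f g =
  trans (Σ-cong N (λ i → sumWords-distrib-+ N n (f ∘ (suc i ∷_)) (g ∘ (suc i ∷_)))) (Σ-distrib-+ N _ _)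

*-distribˡ-sumWords : ∀ N n c (f : List ℕ → ℤ) → c * sumWords N n f ≡ sumWords N n (λ w → c * f w)
*-distribˡ-sumWords N zero    c f = refl
*-distribˡ-sumWords N (suc n) c f =
  trans (*-distribˡ-Σ N c _) (Σ-cong N (λ i → *-distribˡ-sumWords N n c (f ∘ (suc i ∷_))))

*-distribʳ-sumWords : ∀ N n c (f : List ℕ → ℤ) → sumWords N n f * c ≡ sumWords N n (λ w → f w * c)
*-distribʳ-sumWords N zero    c f = refl
*-distribʳ-sumWords N (suc n) c f =
  trans (*-distribʳ-Σ N c _) (Σ-cong N (λ i → *-distribʳ-sumWords N n c (f ∘ (suc i ∷_))))

sumWords-Σ : ∀ N n m (f : List ℕ → ℕ → ℤ) →
  sumWords N n (λ w → Σ[ j < m ] f w j) ≡ Σ[ j < m ] sumWords N n (λ w → f w j)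
sumWords-Σ N zero    m f = refl
sumWords-Σ N (suc n) m f =
  trans (Σ-cong N (λ i → sumWords-Σ N n m (f ∘ (suc i ∷_)))) (Σ-comm N m _)

evenDescent : ℕ → ℕ → ℤ
evenDescent a b = if (b <ᵇ a) ∧ isEven a then 1ℤ else 0ℤ

-- The number of ways to cut w into j blocks: after a leading letter a the cut may be omitted
-- exactly when a and the next letter form a descent from an even letter.
blocks : List ℕ → ℕ → ℤ
blocks []          zero    = 1ℤ
blocks []          (suc j) = 0ℤ
blocks (a ∷ w)     zero    = 0ℤ
blocks (a ∷ [])    (suc j) = blocks [] j
blocks (a ∷ b ∷ w) (suc j) = blocks (b ∷ w) j + evenDescent a b * blocks (b ∷ w) (suc j)

blocks-vanishes : ∀ w {j} → length w < j → blocks w j ≡ 0ℤ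
blocks-vanishes []          {suc j} _         = refl
blocks-vanishes (a ∷ [])    {suc j} (s≤s 0<j) = blocks-vanishes [] 0<j
blocks-vanishes (a ∷ b ∷ w) {suc j} (s≤s ℓ<j) = begin
  blocks (b ∷ w) j + evenDescent a b * blocks (b ∷ w) (suc j)
    ≡⟨ cong₂ (λ x y → x + evenDescent a b * y) (blocks-vanishes (b ∷ w) ℓ<j)
                                              (blocks-vanishes (b ∷ w) (ℕ.m<n⇒m<1+n ℓ<j)) ⟩
  0ℤ + evenDescent a b * 0ℤ
    ≡⟨ trans (+-identityˡ _) (*-zeroʳ (evenDescent a b)) ⟩
  0ℤ ∎

reversedPolynomial : ℕ → (ℕ → ℤ) → Series → Series
reversedPolynomial ℓ b Y = Σₛ (suc ℓ) (λ j → b j ⊙ Y ^ (ℓ ℕ.∸ j))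

⊗-reversedPolynomial : ∀ Y ℓ b → b (suc ℓ) ≡ 0ℤ →
  Y ⊗ reversedPolynomial ℓ b Y ≗ reversedPolynomial (suc ℓ) b Y
⊗-reversedPolynomial Y ℓ b b₍ℓ₊₁₎≡0 m = begin
  (Y ⊗ reversedPolynomial ℓ b Y) m
    ≡⟨ ⊗-distribˡ-Σₛ Y (suc ℓ) _ m ⟩
  Σ[ j < suc ℓ ] (Y ⊗ b j ⊙ Y ^ (ℓ ℕ.∸ j)) m
    ≡⟨ Σ-cong-< (suc ℓ) raise ⟩
  Σ[ j < suc ℓ ] (b j * (Y ^ (suc ℓ ℕ.∸ j)) m)
    ≡⟨ +-identityʳ _ ⟨
  Σ[ j < suc ℓ ] (b j * (Y ^ (suc ℓ ℕ.∸ j)) m) + 0ℤ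
    ≡⟨ cong (_+_ (Σ[ j < suc ℓ ] (b j * (Y ^ (suc ℓ ℕ.∸ j)) m)))
            (trans (cong (_* (Y ^ (ℓ ℕ.∸ ℓ)) m) b₍ℓ₊₁₎≡0) (*-zeroˡ ((Y ^ (ℓ ℕ.∸ ℓ)) m))) ⟨
  reversedPolynomial (suc ℓ) b Y m ∎
  where
  raise : ∀ j → j < suc ℓ → (Y ⊗ b j ⊙ Y ^ (ℓ ℕ.∸ j)) m ≡ b j * (Y ^ (suc ℓ ℕ.∸ j)) m
  raise j j<1+ℓ = trans (⊗-⊙-comm (b j) Y _ m)
    (cong (λ e → b j * (Y ^ e) m) (sym (ℕ.+-∸-assoc 1 (ℕ.≤-pred j<1+ℓ))))

reversedPolynomial-suc : ∀ Y ℓ b → b 0 ≡ 0ℤ →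
  reversedPolynomial (suc ℓ) b Y ≗ Σₛ (suc ℓ) (λ j → b (suc j) ⊙ Y ^ (ℓ ℕ.∸ j))
reversedPolynomial-suc Y ℓ b b₀≡0 m = begin
  reversedPolynomial (suc ℓ) b Y m
    ≡⟨ Σ-uncons (suc ℓ) _ ⟩
  b 0 * (Y ^ suc ℓ) m + Σ[ j < suc ℓ ] (b (suc j) * (Y ^ (ℓ ℕ.∸ j)) m)
    ≡⟨ cong (λ c → c * (Y ^ suc ℓ) m + Σ[ j < suc ℓ ] (b (suc j) * (Y ^ (ℓ ℕ.∸ j)) m)) b₀≡0 ⟩
  0ℤ * (Y ^ suc ℓ) m + Σ[ j < suc ℓ ] (b (suc j) * (Y ^ (ℓ ℕ.∸ j)) m)
    ≡⟨ +-identityˡ _ ⟩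
  Σ[ j < suc ℓ ] (b (suc j) * (Y ^ (ℓ ℕ.∸ j)) m) ∎

blocksPolynomial : List ℕ → Series
blocksPolynomial w = reversedPolynomial (length w) (blocks w) (pred X)

blocksPolynomial-cons : ∀ a b w → blocksPolynomial (a ∷ b ∷ w) ≗
  blocksPolynomial (b ∷ w) ⊕ evenDescent a b ⊙ (pred X ⊗ blocksPolynomial (b ∷ w))
blocksPolynomial-cons a b w m = begin
  reversedPolynomial (suc ℓ) (blocks (a ∷ u)) Y m
    ≡⟨ reversedPolynomial-suc Y ℓ (blocks (a ∷ u)) refl m ⟩
  Σ[ j < suc ℓ ] ((blocks u j + e * blocks u (suc j)) * (Y ^ (ℓ ℕ.∸ j)) m)
    ≡⟨ Σ-cong (suc ℓ) (λ j → distrib (blocks u j) e (blocks u (suc j)) ((Y ^ (ℓ ℕ.∸ j)) m)) ⟩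
  Σ[ j < suc ℓ ] (blocks u j * (Y ^ (ℓ ℕ.∸ j)) m + e * (blocks u (suc j) * (Y ^ (ℓ ℕ.∸ j)) m))
    ≡⟨ Σ-distrib-+ (suc ℓ) _ _ ⟩
  blocksPolynomial u m + Σ[ j < suc ℓ ] (e * (blocks u (suc j) * (Y ^ (ℓ ℕ.∸ j)) m))
    ≡⟨ cong (_+_ (blocksPolynomial u m)) (*-distribˡ-Σ (suc ℓ) e _) ⟨
  blocksPolynomial u m + e * Σ[ j < suc ℓ ] (blocks u (suc j) * (Y ^ (ℓ ℕ.∸ j)) m)
    ≡⟨ cong (λ s → blocksPolynomial u m + e * s) (reversedPolynomial-suc Y ℓ (blocks u) refl m) ⟨
  blocksPolynomial u m + e * reversedPolynomial (suc ℓ) (blocks u) Y m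
    ≡⟨ cong (λ s → blocksPolynomial u m + e * s)
            (⊗-reversedPolynomial Y ℓ (blocks u) (blocks-vanishes u (ℕ.n<1+n ℓ)) m) ⟨
  blocksPolynomial u m + e * (Y ⊗ blocksPolynomial u) m ∎
  where
  u : List ℕ
  u = b ∷ w
  ℓ : ℕ
  ℓ = length u
  e : ℤ
  e = evenDescent a b
  Y : Series
  Y = pred X
  distrib : ∀ x e y z → (x + e * y) * z ≡ x * z + e * (y * z)
  distrib = solve-∀

X^-desX-cons : ∀ a b w → X ^ desX isEven (a ∷ b ∷ w) ≗
  X ^ desX isEven (b ∷ w) ⊕ evenDescent a b ⊙ (pred X ⊗ X ^ desX isEven (b ∷ w))
X^-desX-cons a b w m with (b <ᵇ a) ∧ isEven a
... | true  = sym (trans (cong (λ s → G m + 1ℤ * s) (pred-⊗ X G m)) (cancel (G m) ((X ⊗ G) m)))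
  where
  G : Series
  G = X ^ desX isEven (b ∷ w)
  cancel : ∀ g x → g + 1ℤ * (x - g) ≡ x
  cancel = solve-∀
... | false = sym (+-identityʳ ((X ^ desX isEven (b ∷ w)) m))

desX-expansion : ∀ w → X ^ desX isEven w ≗ blocksPolynomial w
desX-expansion []          m = sym (trans (+-identityˡ _) (*-identityˡ (1ₛ m)))
desX-expansion (a ∷ [])    m = sym (trans (+-identityˡ _) (*-identityˡ (1ₛ m)))
desX-expansion (a ∷ b ∷ w) m = begin
  (X ^ desX isEven (a ∷ b ∷ w)) m
    ≡⟨ X^-desX-cons a b w m ⟩
  (X ^ desX isEven (b ∷ w) ⊕ evenDescent a b ⊙ (pred X ⊗ X ^ desX isEven (b ∷ w))) m
    ≡⟨ ⊕-cong (desX-expansion (b ∷ w))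
              (λ i → cong (evenDescent a b *_) (⊗-congˡ (pred X) (desX-expansion (b ∷ w)) i)) m ⟩
  (blocksPolynomial (b ∷ w) ⊕ evenDescent a b ⊙ (pred X ⊗ blocksPolynomial (b ∷ w))) m
    ≡⟨ blocksPolynomial-cons a b w m ⟨
  blocksPolynomial (a ∷ b ∷ w) m ∎

-- Counting words by their blocks

module _ (N : ℕ) where

  blockCount : ℕ → ℕ → ℤ
  blockCount n j = sumWords N n (λ w → blocks w j)

  blockCountFrom : ℕ → ℕ → ℕ → ℤ
  blockCountFrom n a j = sumWords N n (λ w → blocks (a ∷ w) j)

  prefixBlockCount : ℕ → ℕ → ℕ → ℤ
  prefixBlockCount n c j = Σ[ i < c ] blockCountFrom n (suc i) (suc j)

  blockCountFrom-suc : ∀ m a j → blockCountFrom (suc m) a (suc j) ≡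
    blockCount (suc m) j + Σ[ i < N ] (evenDescent a (suc i) * blockCountFrom m (suc i) (suc j))
  blockCountFrom-suc m a j = trans (Σ-cong N split) (Σ-distrib-+ N _ _)
    where
    split : ∀ i →
      sumWords N m (λ w → blocks (suc i ∷ w) j + evenDescent a (suc i) * blocks (suc i ∷ w) (suc j))
      ≡ blockCountFrom m (suc i) j + evenDescent a (suc i) * blockCountFrom m (suc i) (suc j)
    split i = trans (sumWords-distrib-+ N m _ _) (cong (_+_ (blockCountFrom m (suc i) j))
                    (sym (*-distribˡ-sumWords N m (evenDescent a (suc i)) _)))

  Σ-evenDescent : ∀ c (g : ℕ → ℤ) → c < N →
    Σ[ i < N ] (evenDescent (suc c) (suc i) * g i) ≡ (if isEven (suc c) then Σ< c g else 0ℤ)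
  Σ-evenDescent c g c<N with isEven (suc c)
  ... | true  = trans (Σ-cong N (λ i → cong (λ b → (if b then 1ℤ else 0ℤ) * g i) (∧-identityʳ (i <ᵇ c))))
                      (Σ-indicator-< g (ℕ.<⇒≤ c<N))
  ... | false = Σ-zero N (λ i _ → cong (λ b → (if b then 1ℤ else 0ℤ) * g i) (∧-zeroʳ (i <ᵇ c)))

  -- A simultaneous induction on n: the first-letter counts at n rest on the counts at n − 1.
  blockCount-coefficient : ∀ n j → blockCount n j ≡ (blockSeries N ^ j) n
  prefixBlockCount-coefficient : ∀ n c → c ≤ N → ∀ j →
    prefixBlockCount n c j ≡ (blockSeries c ⊗ blockSeries N ^ j) (suc n)
  blockCountFrom-coefficient : ∀ n c → c < N → ∀ j →
    blockCountFrom n (suc c) (suc j) ≡ (blockSeries N ^ j) n + (continuations c ⊗ blockSeries N ^ j) n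

  blockCount-coefficient zero    zero    = refl
  blockCount-coefficient zero    (suc j) = sym (cong (_* (blockSeries N ^ j) 0) (blockSeries-constant N))
  blockCount-coefficient (suc n) zero    = Σ-zero N (λ i _ → sumWords-zero N n (λ _ → refl))
  blockCount-coefficient (suc n) (suc j) = prefixBlockCount-coefficient n N ℕ.≤-refl j

  prefixBlockCount-coefficient n zero    _     j = sym (⊗-zeroˡ (blockSeries N ^ j) (suc n))
  prefixBlockCount-coefficient n (suc c) 1+c≤N j = begin
    prefixBlockCount n c j + blockCountFrom n (suc c) (suc j)
      ≡⟨ cong₂ _+_ (prefixBlockCount-coefficient n c (ℕ.<⇒≤ 1+c≤N) j)
                   (blockCountFrom-coefficient n c 1+c≤N j) ⟩
    (blockSeries c ⊗ G) (suc n) + (G n + (continuations c ⊗ G) n)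
      ≡⟨ blockSeries-suc-⊗ c G n ⟨
    (blockSeries (suc c) ⊗ G) (suc n) ∎
    where
    G : Series
    G = blockSeries N ^ j

  blockCountFrom-coefficient zero    c _   j = begin
    blockCount zero j                   ≡⟨ blockCount-coefficient zero j ⟩
    G 0                                 ≡⟨ +-identityʳ (G 0) ⟨
    G 0 + 0ℤ                            ≡⟨ cong (_+_ (G 0)) (trans (cong (_* G 0) (continuations-constant c))
                                                                   (*-zeroˡ (G 0))) ⟨
    G 0 + (continuations c ⊗ G) 0       ∎
    where
    G : Series
    G = blockSeries N ^ j
  blockCountFrom-coefficient (suc m) c c<N j = begin
    blockCountFrom (suc m) (suc c) (suc j)
      ≡⟨ blockCountFrom-suc m (suc c) j ⟩
    blockCount (suc m) j + Σ[ i < N ] (evenDescent (suc c) (suc i) * blockCountFrom m (suc i) (suc j))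
      ≡⟨ cong₂ _+_ (blockCount-coefficient (suc m) j) (Σ-evenDescent c _ c<N) ⟩
    G (suc m) + (if isEven (suc c) then prefixBlockCount m c j else 0ℤ)
      ≡⟨ cong (_+_ (G (suc m))) continuation ⟩
    G (suc m) + (continuations c ⊗ G) (suc m) ∎
    where
    G : Series
    G = blockSeries N ^ j
    continuation : (if isEven (suc c) then prefixBlockCount m c j else 0ℤ) ≡ (continuations c ⊗ G) (suc m)
    continuation with isEven (suc c)
    ... | true  = prefixBlockCount-coefficient m c (ℕ.<⇒≤ c<N) j
    ... | false = sym (⊗-zeroˡ G (suc m))

countWords-by-blocks : ∀ N n p → + countWords N n (λ π → desX isEven π ≡ᵇ p) ≡
  Σ[ j < suc n ] (blockCount N n j * signedBinomial (n ℕ.∸ j) p)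
countWords-by-blocks N n p = begin
  + countWords N n (λ π → desX isEven π ≡ᵇ p)
    ≡⟨ countWords-sumWords N n _ ⟩
  sumWords N n (λ w → if desX isEven w ≡ᵇ p then 1ℤ else 0ℤ)
    ≡⟨ sumWords-cong N n (λ w |w|≡n _ → trans (expand w) (cong (λ ℓ → Σ[ j < suc ℓ ] t w ℓ j) |w|≡n)) ⟩
  sumWords N n (λ w → Σ[ j < suc n ] t w n j)
    ≡⟨ sumWords-Σ N n (suc n) (λ w → t w n) ⟩
  Σ[ j < suc n ] sumWords N n (λ w → t w n j)
    ≡⟨ Σ-cong (suc n) (λ j → *-distribʳ-sumWords N n _ (λ w → blocks w j)) ⟨
  Σ[ j < suc n ] (blockCount N n j * signedBinomial (n ℕ.∸ j) p) ∎
  where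
  t : List ℕ → ℕ → ℕ → ℤ
  t w ℓ j = blocks w j * signedBinomial (ℓ ℕ.∸ j) p
  expand : ∀ w → (if desX isEven w ≡ᵇ p then 1ℤ else 0ℤ) ≡ Σ[ j < suc (length w) ] t w (length w) j
  expand w = begin
    (if desX isEven w ≡ᵇ p then 1ℤ else 0ℤ)   ≡⟨ X^-coefficient (desX isEven w) p ⟨
    (X ^ desX isEven w) p                     ≡⟨ desX-expansion w p ⟩
    blocksPolynomial w p                      ≡⟨ Σ-cong (suc (length w)) (λ j →
                                                   cong (blocks w j *_) (X-1^-coefficient (length w ℕ.∸ j) p)) ⟩
    Σ[ j < suc (length w) ] t w (length w) j  ∎

signed-product : ∀ {j n} i p (x c₂ c₃ c₄ : ℕ) → j ≤ n →
  + x * (sign (j ℕ.+ i) * + c₂ * + c₃) * (sign (n ℕ.∸ j ℕ.+ p) * + c₄) ≡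
  sign (n ℕ.+ p ℕ.+ i) * + (x ℕ.* c₂ ℕ.* c₃ ℕ.* c₄)
signed-product {j} {n} i p x c₂ c₃ c₄ j≤n = begin
  + x * (sign (j ℕ.+ i) * + c₂ * + c₃) * (sign (n ℕ.∸ j ℕ.+ p) * + c₄)
    ≡⟨ rearrange (+ x) (+ c₂) (+ c₃) (+ c₄) (sign (j ℕ.+ i)) (sign (n ℕ.∸ j ℕ.+ p)) ⟩
  sign (j ℕ.+ i) * sign (n ℕ.∸ j ℕ.+ p) * (+ x * + c₂ * + c₃ * + c₄)
    ≡⟨ cong₂ _*_ (trans (sym (sign-+ (j ℕ.+ i) _)) (cong sign exponents)) casts ⟩
  sign (n ℕ.+ p ℕ.+ i) * + (x ℕ.* c₂ ℕ.* c₃ ℕ.* c₄) ∎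
  where
  rearrange : ∀ x c₂ c₃ c₄ σ τ → x * (σ * c₂ * c₃) * (τ * c₄) ≡ σ * τ * (x * c₂ * c₃ * c₄)
  rearrange = solve-∀
  exponents : j ℕ.+ i ℕ.+ (n ℕ.∸ j ℕ.+ p) ≡ n ℕ.+ p ℕ.+ i
  exponents = trans (regroup j i (n ℕ.∸ j) p) (cong (λ m → m ℕ.+ p ℕ.+ i) (ℕ.m+[n∸m]≡n j≤n))
    where
    regroup : ∀ j i e p → j ℕ.+ i ℕ.+ (e ℕ.+ p) ≡ j ℕ.+ e ℕ.+ p ℕ.+ i
    regroup = ℕ-Solver.solve-∀
  casts : + x * + c₂ * + c₃ * + c₄ ≡ + (x ℕ.* c₂ ℕ.* c₃ ℕ.* c₄)
  casts = sym (trans (pos-* (x ℕ.* c₂ ℕ.* c₃) c₄)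
                     (cong (_* + c₄) (trans (pos-* (x ℕ.* c₂) c₃) (cong (_* + c₃) (pos-* x c₂)))))

rhs-summand : ∀ k n p j → j ≤ n →
  (blockSeries (2 ℕ.* k) ^ j) n * signedBinomial (n ℕ.∸ j) p
  ≡ sumTo j (λ i₁ → sumTo j (λ i₂ → sign (n ℕ.+ p ℕ.+ i₂) *
      + (2 ℕ.^ (j ℕ.∸ i₁) ℕ.* (j C i₁) ℕ.* (j C i₂) ℕ.* ((k ℕ.* i₂) C (n ℕ.∸ i₁)) ℕ.* ((n ℕ.∸ j) C p))))
rhs-summand k n p j j≤n = begin
  (blockSeries (2 ℕ.* k) ^ j) n * s
    ≡⟨ cong (_* s) (blockSeries-^-coefficient k j n) ⟩
  Σ[ i₁ < suc n ] (a i₁ * Σ[ i₂ < suc j ] g i₁ i₂) * s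
    ≡⟨ cong (_* s) (Σ-truncate (s≤s j≤n) vanish) ⟩
  Σ[ i₁ < suc j ] (a i₁ * Σ[ i₂ < suc j ] g i₁ i₂) * s
    ≡⟨ *-distribʳ-Σ (suc j) s _ ⟩
  Σ[ i₁ < suc j ] (a i₁ * Σ[ i₂ < suc j ] g i₁ i₂ * s)
    ≡⟨ Σ-cong (suc j) (λ i₁ →
         trans (cong (_* s) (*-distribˡ-Σ (suc j) (a i₁) (g i₁))) (*-distribʳ-Σ (suc j) s _)) ⟩
  Σ[ i₁ < suc j ] Σ[ i₂ < suc j ] (a i₁ * g i₁ i₂ * s)
    ≡⟨ Σ-cong (suc j) (λ i₁ → Σ-cong (suc j) (λ i₂ → signed-product i₂ p
         (2 ℕ.^ (j ℕ.∸ i₁) ℕ.* (j C i₁)) (j C i₂) ((k ℕ.* i₂) C (n ℕ.∸ i₁)) ((n ℕ.∸ j) C p) j≤n)) ⟩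
  Σ[ i₁ < suc j ] Σ[ i₂ < suc j ] t i₁ i₂
    ≡⟨ trans (sumTo-Σ j _) (Σ-cong (suc j) (λ i₁ → sumTo-Σ j (t i₁))) ⟨
  sumTo j (λ i₁ → sumTo j (t i₁)) ∎
  where
  s : ℤ
  s = signedBinomial (n ℕ.∸ j) p
  a : ℕ → ℤ
  a i₁ = + (2 ℕ.^ (j ℕ.∸ i₁) ℕ.* (j C i₁))
  g : ℕ → ℕ → ℤ
  g i₁ i₂ = signedBinomial j i₂ * + ((k ℕ.* i₂) C (n ℕ.∸ i₁))
  t : ℕ → ℕ → ℤ
  t i₁ i₂ = sign (n ℕ.+ p ℕ.+ i₂) *
    + (2 ℕ.^ (j ℕ.∸ i₁) ℕ.* (j C i₁) ℕ.* (j C i₂) ℕ.* ((k ℕ.* i₂) C (n ℕ.∸ i₁)) ℕ.* ((n ℕ.∸ j) C p))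
  vanish : ∀ i₁ → suc j ≤ i₁ → a i₁ * Σ[ i₂ < suc j ] g i₁ i₂ ≡ 0ℤ
  vanish i₁ j<i₁ = begin
    + (2 ℕ.^ (j ℕ.∸ i₁) ℕ.* (j C i₁)) * Σ[ i₂ < suc j ] g i₁ i₂
      ≡⟨ cong (λ c → + (2 ℕ.^ (j ℕ.∸ i₁) ℕ.* c) * Σ[ i₂ < suc j ] g i₁ i₂) (k>n⇒nCk≡0 j<i₁) ⟩
    + (2 ℕ.^ (j ℕ.∸ i₁) ℕ.* 0) * Σ[ i₂ < suc j ] g i₁ i₂
      ≡⟨ cong (λ c → + c * Σ[ i₂ < suc j ] g i₁ i₂) (ℕ.*-zeroʳ (2 ℕ.^ (j ℕ.∸ i₁))) ⟩
    0ℤ * Σ[ i₂ < suc j ] g i₁ i₂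
      ≡⟨ *-zeroˡ (Σ[ i₂ < suc j ] g i₁ i₂) ⟩
    0ℤ ∎

countWords-desX-rhs : ∀ k n p → + countWords (2 ℕ.* k) n (λ π → desX isEven π ≡ᵇ p) ≡ rhs k n p
countWords-desX-rhs k n p = begin
  + countWords (2 ℕ.* k) n (λ π → desX isEven π ≡ᵇ p)
    ≡⟨ countWords-by-blocks (2 ℕ.* k) n p ⟩
  Σ[ j < suc n ] (blockCount (2 ℕ.* k) n j * signedBinomial (n ℕ.∸ j) p)
    ≡⟨ Σ-cong-< (suc n) (λ j j<1+n →
         trans (cong (_* signedBinomial (n ℕ.∸ j) p) (blockCount-coefficient (2 ℕ.* k) n j))
               (rhs-summand k n p j (ℕ.≤-pred j<1+n))) ⟩
  Σ[ j < suc n ] sumTo j (λ i₁ → sumTo j (λ i₂ → sign (n ℕ.+ p ℕ.+ i₂) *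
      + (2 ℕ.^ (j ℕ.∸ i₁) ℕ.* (j C i₁) ℕ.* (j C i₂) ℕ.* ((k ℕ.* i₂) C (n ℕ.∸ i₁)) ℕ.* ((n ℕ.∸ j) C p))))
    ≡⟨ sumTo-Σ n _ ⟨
  rhs k n p ∎

-- Complementation

complement : ℕ → ℕ → ℕ
complement N a = suc N ℕ.∸ a

sumWords-complement : ∀ N n f → sumWords N n f ≡ sumWords N n (f ∘ map (complement N))
sumWords-complement N zero    f = refl
sumWords-complement N (suc n) f = begin
  Σ[ i < N ] sumWords N n (λ w → f (suc i ∷ w))
    ≡⟨ Σ-cong N (λ i → sumWords-complement N n (λ w → f (suc i ∷ w))) ⟩
  Σ[ i < N ] sumWords N n (λ w → f (suc i ∷ map (complement N) w))
    ≡⟨ Σ-reverse N _ ⟩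
  Σ[ i < N ] sumWords N n (λ w → f (suc (N ℕ.∸ suc i) ∷ map (complement N) w))
    ≡⟨ Σ-cong-< N (λ i i<N →
         cong (λ a → sumWords N n (λ w → f (a ∷ map (complement N) w))) (ℕ.+-∸-assoc 1 i<N)) ⟨
  Σ[ i < N ] sumWords N n (λ w → f (complement N (suc i) ∷ map (complement N) w)) ∎

<ᵇ-complement : ∀ {m a b} → a ≤ m → (m ℕ.∸ a <ᵇ m ℕ.∸ b) ≡ (b <ᵇ a)
<ᵇ-complement {m} {a} {b} a≤m = det (ℕ.<ᵇ-reflects-< (m ℕ.∸ a) (m ℕ.∸ b)) (fromEquivalence
  (λ b<ᵇa → ℕ.∸-monoʳ-< (ℕ.<ᵇ⇒< b a b<ᵇa) a≤m)
  (λ m∸a<m∸b → ℕ.<⇒<ᵇ (ℕ.∸-cancelʳ-< {a} {b} {m} m∸a<m∸b)))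

isEven-+ : ∀ x y → isEven (x ℕ.+ y) ≡ (if isEven x then isEven y else not (isEven y))
isEven-+ zero    y = refl
isEven-+ (suc x) y rewrite isEven-+ x y with isEven x
... | true  = refl
... | false = not-involutive (isEven y)

isOdd-complement : ∀ N a → isEven N ≡ true → a ≤ N → isOdd (complement N a) ≡ isEven a
isOdd-complement N a N-even a≤N = opposite-parities (isEven (complement N a)) (isEven a) sum-odd
  where
  sum-odd : (if isEven (complement N a) then isEven a else not (isEven a)) ≡ false
  sum-odd = begin
    (if isEven (complement N a) then isEven a else not (isEven a))  ≡⟨ isEven-+ (complement N a) a ⟨
    isEven (complement N a ℕ.+ a)                                    ≡⟨ cong isEven (ℕ.m∸n+n≡m (ℕ.m≤n⇒m≤1+n a≤N)) ⟩
    not (isEven N)                                                   ≡⟨ cong not N-even ⟩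
    false                                                            ∎
  opposite-parities : ∀ x y → (if x then y else not y) ≡ false → not x ≡ y
  opposite-parities true  false _ = refl
  opposite-parities false true  _ = refl

risX-complement : ∀ N → isEven N ≡ true → ∀ w → All (_≤ N) w →
  risX isOdd (map (complement N) w) ≡ desX isEven w
risX-complement N N-even []          _                 = refl
risX-complement N N-even (a ∷ [])    _                 = refl
risX-complement N N-even (a ∷ b ∷ w) (a≤N ∷ b≤N ∷ w≤N) =
  cong₂ (λ d r → (if d then 1 else 0) ℕ.+ r)
        (cong₂ _∧_ (<ᵇ-complement (ℕ.m≤n⇒m≤1+n a≤N)) (isOdd-complement N a N-even a≤N))
        (risX-complement N N-even (b ∷ w) (b≤N ∷ w≤N))

risX-desX-equidistributed : ∀ N n (P : ℕ → Bool) → isEven N ≡ true →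
  countWords N n (P ∘ risX isOdd) ≡ countWords N n (P ∘ desX isEven)
risX-desX-equidistributed N n P N-even = +-injective (begin
  + countWords N n (P ∘ risX isOdd)
    ≡⟨ countWords-sumWords N n _ ⟩
  sumWords N n (λ w → if P (risX isOdd w) then 1ℤ else 0ℤ)
    ≡⟨ sumWords-complement N n _ ⟩
  sumWords N n (λ w → if P (risX isOdd (map (complement N) w)) then 1ℤ else 0ℤ)
    ≡⟨ sumWords-cong N n (λ w _ w≤N →
         cong (λ d → if P d then 1ℤ else 0ℤ) (risX-complement N N-even w w≤N)) ⟩
  sumWords N n (λ w → if P (desX isEven w) then 1ℤ else 0ℤ)
    ≡⟨ countWords-sumWords N n _ ⟨
  + countWords N n (P ∘ desX isEven) ∎)

corollary5p2 : (k n p : ℕ) → 1 ≤ k →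
    (+ countWords (2 ℕ.* k) n (λ π → desX isEven π ≡ᵇ p) ≡ rhs k n p)
    × (countWords (2 ℕ.* k) n (λ π → risX isOdd π ≡ᵇ p)
       ≡ countWords (2 ℕ.* k) n (λ π → desX isEven π ≡ᵇ p))
-- Both identities also hold for k = 0.
corollary5p2 k n p _ =
  countWords-desX-rhs k n p , risX-desX-equidistributed (2 ℕ.* k) n (_≡ᵇ p) (isEven-double k)
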